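{- For every $n\geq 0$, the number of symmetric alternative tableaux of length $2n$ equals $2^n n!$.
   Context: A shape of length $n$ is a Ferrers diagram in English notation (possibly with empty rows or columns), determined by its south-east border, a path of $n$ unit south/west steps from the top-right to the bottom-left corner; south steps correspond to rows, west steps to columns. An alternative tableau is a shape with a partial filling of cells by left arrows and up arrows such that every cell to the left of a left arrow in its row, and every cell above an up arrow in its column, is empty. Its length is that of its shape. The transpose of an alternative tableau is its reflection across the main diagonal (the line going south-east from the top-left corner). It exchanges rows with columns and left arrows with up arrows. An alternative tableau is symmetric if it equals its transpose. -}

module Defs where

open import Data.Bool using (Bool; true; false; _∧_; not; T; if_then_else_)
open import Data.Nat using (ℕ; _<ᵇ_)
open import Data.Fin using (Fin; toℕ; opposite; zero; suc)
open import Data.Vec using (Vec; lookup; tabulate)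
open import Data.Product using (Σ; _×_; _,_; proj₁)
open import Relation.Binary.PropositionalEquality using (_≡_)

-- A step of the south-east border path (read from the top-right to the
-- bottom-left corner).  South steps are rows, west steps are columns.
data Step : Set where
  south west : Step

data Content : Set where
  empty left up : Content

Shape : ℕ → Set
Shape n = Vec Step n

-- Rows are indexed by the positions p of south steps (top to bottom),
-- columns by the positions q of west steps (right to left).
-- The cell in row p and column q exists iff p < q (the west step q comes
-- after the south step p on the path).
isSouth isWest : Step → Bool
isSouth south = true
isSouth west  = false
isWest  s     = not (isSouth s)

isCell : ∀ {n} → Shape n → Fin n → Fin n → Bool
isCell s p q = (toℕ p <ᵇ toℕ q) ∧ isSouth (lookup s p) ∧ isWest (lookup s q)

-- A (partial) filling, stored as an n × n array indexed by positions;
-- entries outside the cells of the shape are required to be empty.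
Filling : ℕ → Set
Filling n = Vec (Vec Content n) n

at : ∀ {n} → Filling n → Fin n → Fin n → Content
at f p q = lookup (lookup f p) q

isEmpty isLeft isUp : Content → Bool
isEmpty empty = true
isEmpty _     = false
isLeft left = true
isLeft _    = false
isUp up = true
isUp _  = false

_⇒ᵇ_ : Bool → Bool → Bool
a ⇒ᵇ b = not a Data.Bool.∨ b

∀Fin : ∀ n → (Fin n → Bool) → Bool
∀Fin ℕ.zero    P = true
∀Fin (ℕ.suc n) P = P zero ∧ ∀Fin n (λ i → P (suc i))

isAlternative : ∀ {n} → Shape n × Filling n → Bool
isAlternative {n} (s , f) =
  ∀Fin n (λ p → ∀Fin n (λ q → not (isCell s p q) ⇒ᵇ isEmpty (at f p q)))
  -- every cell to the left of a left arrow in its row is empty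
  ∧ ∀Fin n (λ p → ∀Fin n (λ q → isLeft (at f p q) ⇒ᵇ
      ∀Fin n (λ q' → ((toℕ q <ᵇ toℕ q') ∧ isCell s p q') ⇒ᵇ isEmpty (at f p q'))))
  -- every cell above an up arrow in its column is empty
  ∧ ∀Fin n (λ p → ∀Fin n (λ q → isUp (at f p q) ⇒ᵇ
      ∀Fin n (λ p' → ((toℕ p' <ᵇ toℕ p) ∧ isCell s p' q) ⇒ᵇ isEmpty (at f p' q))))

AltTableau : ℕ → Set
AltTableau n = Σ (Shape n × Filling n) (λ x → T (isAlternative x))

-- The border path is
-- reversed with south/west exchanged (position k ↦ n-1-k); the cell
-- (p , q) goes to (n-1-q , n-1-p); left and up arrows are exchanged.
swapStep : Step → Step
swapStep south = west
swapStep west  = south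

swapContent : Content → Content
swapContent empty = empty
swapContent left  = up
swapContent up    = left

transpose : ∀ {n} → Shape n × Filling n → Shape n × Filling n
transpose (s , f) =
  ( tabulate (λ i → swapStep (lookup s (opposite i)))
  , tabulate (λ i → tabulate (λ j → swapContent (at f (opposite j) (opposite i)))) )

SymAltTableau : ℕ → Set
SymAltTableau n = Σ (AltTableau n) (λ t → transpose (proj₁ t) ≡ proj₁ t)

module Submission where

-- A symmetric tableau of length m+2 is an outer layer (first and last step
-- of the border: the top row and its mirror image, the leftmost column)
-- around a symmetric tableau of length m.  Given the inner tableau, the
-- layer is determined by a set S of free columns (columns without up arrow)
-- receiving an arrow in the top row, and a bit b: for S non-empty, whether
-- the last arrow of the top row is a left arrow; for S empty, whether the
-- first step is west (addLayer / peelLayer, layer-decomposition).  The new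
-- tableau has 1 + (free columns outside S) free columns (FreeColumns).
-- Weighting tableaux by w^(free columns) thus gives G(n+1, w) = 2w·G(n, w+1),
-- so G(n, w) = 2ⁿ·w(w+1)⋯(w+n-1).  We prove this bijectively, counting
-- tableaux with free columns labelled by Fin w (weighted-count, using
-- labelled↔ for the sum over S); the theorem is the case w = 1.

open import Defs
open import Data.Bool using (Bool; true; false; _∧_; _∨_; not; T; if_then_else_)
open import Data.Bool.Properties using (∨-zeroʳ; ∧-zeroʳ; ∧-identityʳ; ∧-comm; ∧-assoc; T-irrelevant)
open import Data.Nat using (ℕ; zero; suc; _+_; _*_; _^_; _<_; _≤_; z≤n; s≤s; _<ᵇ_)
open import Data.Nat.Base using (_!)
import Data.Nat.Properties as ℕP
open import Data.Nat.Solver using (module +-*-Solver)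
open import Data.Fin using (Fin; toℕ; opposite; zero; suc; inject₁; fromℕ)
import Data.Fin.Properties as FP
import Data.Fin.Relation.Unary.Top as Top
open import Data.Vec using (Vec; []; _∷_; lookup; tabulate; replicate)
open import Data.Vec.Properties using (lookup∘tabulate; tabulate∘lookup; tabulate-cong)
import Data.Vec.Properties as VP
open import Data.Product using (Σ; _×_; _,_; proj₁; proj₂)
import Data.Product.Properties as PP
open import Data.Product.Function.NonDependent.Propositional using (_×-↔_)
open import Data.Product.Function.Dependent.Propositional using (Σ-↔)
open import Data.Empty using (⊥; ⊥-elim)
open import Data.Unit using (tt)
open import Relation.Binary.PropositionalEquality
open import Relation.Binary.Definitions using (DecidableEquality; tri<; tri≈; tri>)
open import Relation.Nullary using (¬_; yes; no)
import Axiom.UniquenessOfIdentityProofs as UIP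
open import Function using (_∘_)
open import Function.Bundles using (_↔_; mk↔ₛ′; Inverse)
open import Function.Properties.Inverse using (↔-trans; ↔-sym; ↔-refl)
open +-*-Solver using (solve; _:*_; _:=_; con)

true≢false : true ≡ false → ⊥
true≢false ()

∧-true : ∀ {a b} → a ≡ true → b ≡ true → a ∧ b ≡ true
∧-true refl refl = refl

∧-trueˡ : ∀ a {b} → a ∧ b ≡ true → a ≡ true
∧-trueˡ true _ = refl

∧-trueʳ : ∀ a {b} → a ∧ b ≡ true → b ≡ true
∧-trueʳ true p = p

not-elim : ∀ {a} → not a ≡ true → a ≡ false
not-elim {false} _ = refl

not-intro : ∀ {a} → a ≡ false → not a ≡ true
not-intro refl = refl

⇒ᵇ-elim : ∀ a {b} → (a ⇒ᵇ b) ≡ true → a ≡ true → b ≡ true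
⇒ᵇ-elim true h refl = h

⇒ᵇ-intro : ∀ a {b} → (a ≡ true → b ≡ true) → (a ⇒ᵇ b) ≡ true
⇒ᵇ-intro true h = h refl
⇒ᵇ-intro false h = refl

not≡false : ∀ {a} → not a ≡ false → a ≡ true
not≡false {true} _ = refl

contraposeᵇ : ∀ {a b : Bool} → (a ≡ true → b ≡ true) → b ≡ false → a ≡ false
contraposeᵇ {false} h e = refl
contraposeᵇ {true} h e = sym (trans (sym e) (h refl))

bool-ext : ∀ {a b : Bool} → (a ≡ true → b ≡ true) → (b ≡ true → a ≡ true) → a ≡ b
bool-ext {false} {false} f g = refl
bool-ext {false} {true}  f g = g refl
bool-ext {true}  {false} f g = sym (f refl)
bool-ext {true}  {true}  f g = refl

T⇒≡ : ∀ {x} → T x → x ≡ true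
T⇒≡ {true} _ = refl

≡⇒T : ∀ {x} → x ≡ true → T x
≡⇒T refl = tt

<ᵇ-elim : ∀ {a b} → (a <ᵇ b) ≡ true → a < b
<ᵇ-elim {a} {b} h = ℕP.<ᵇ⇒< a b (≡⇒T h)

<ᵇ-intro : ∀ {a b} → a < b → (a <ᵇ b) ≡ true
<ᵇ-intro h = T⇒≡ (ℕP.<⇒<ᵇ h)

<ᵇ-false : ∀ {a b} → ¬ (a < b) → (a <ᵇ b) ≡ false
<ᵇ-false {a} {b} h with a <ᵇ b in e
... | false = refl
... | true = ⊥-elim (h (<ᵇ-elim e))

isEmpty-elim : ∀ {c} → isEmpty c ≡ true → c ≡ empty
isEmpty-elim {empty} _ = refl

isEmpty-intro : ∀ {c} → c ≡ empty → isEmpty c ≡ true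
isEmpty-intro refl = refl

isLeft-elim : ∀ {c} → isLeft c ≡ true → c ≡ left
isLeft-elim {left} _ = refl

isLeft-intro : ∀ {c} → c ≡ left → isLeft c ≡ true
isLeft-intro refl = refl

isUp-elim : ∀ {c} → isUp c ≡ true → c ≡ up
isUp-elim {up} _ = refl

isUp-intro : ∀ {c} → c ≡ up → isUp c ≡ true
isUp-intro refl = refl

∀Fin-elim : ∀ n (P : Fin n → Bool) → ∀Fin n P ≡ true → ∀ i → P i ≡ true
∀Fin-elim (suc n) P h zero = ∧-trueˡ (P zero) h
∀Fin-elim (suc n) P h (suc i) = ∀Fin-elim n (P ∘ suc) (∧-trueʳ (P zero) h) i

∀Fin-intro : ∀ n (P : Fin n → Bool) → (∀ i → P i ≡ true) → ∀Fin n P ≡ true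
∀Fin-intro zero P h = refl
∀Fin-intro (suc n) P h = ∧-true (h zero) (∀Fin-intro n (P ∘ suc) (h ∘ suc))

∀Fin-counterexample : ∀ n (P : Fin n → Bool) → ∀Fin n P ≡ false → Σ (Fin n) (λ i → P i ≡ false)
∀Fin-counterexample (suc n) P h with P zero in e
... | false = zero , e
... | true = let (i , q) = ∀Fin-counterexample n (P ∘ suc) h in suc i , q

∀Fin-cong : ∀ n {P Q : Fin n → Bool} → (∀ i → P i ≡ Q i) → ∀Fin n P ≡ ∀Fin n Q
∀Fin-cong zero h = refl
∀Fin-cong (suc n) h = cong₂ _∧_ (h zero) (∀Fin-cong n (h ∘ suc))

⟦_⟧ : Bool → ℕ
⟦ true ⟧ = 1
⟦ false ⟧ = 0

#Fin : ∀ n → (Fin n → Bool) → ℕ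
#Fin zero P = 0
#Fin (suc n) P = ⟦ P zero ⟧ + #Fin n (P ∘ suc)

#Fin-cong : ∀ n {P Q : Fin n → Bool} → (∀ i → P i ≡ Q i) → #Fin n P ≡ #Fin n Q
#Fin-cong zero h = refl
#Fin-cong (suc n) h = cong₂ _+_ (cong ⟦_⟧ (h zero)) (#Fin-cong n (h ∘ suc))

#Fin-snoc : ∀ n (P : Fin (suc n) → Bool) → #Fin (suc n) P ≡ #Fin n (P ∘ inject₁) + ⟦ P (fromℕ n) ⟧
#Fin-snoc zero P = ℕP.+-identityʳ _
#Fin-snoc (suc n) P = trans (cong (⟦ P zero ⟧ +_) (#Fin-snoc n (P ∘ suc))) (sym (ℕP.+-assoc ⟦ P zero ⟧ _ _))

record Valid {n} (s : Shape n) (f : Filling n) : Set where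
  field
    outside-empty : ∀ p q → isCell s p q ≡ false → at f p q ≡ empty
    left-clear    : ∀ p q q' → at f p q ≡ left → toℕ q < toℕ q' → isCell s p q' ≡ true → at f p q' ≡ empty
    up-clear      : ∀ p q p' → at f p q ≡ up → toℕ p' < toℕ p → isCell s p' q ≡ true → at f p' q ≡ empty

record Symmetric {n} (s : Shape n) (f : Filling n) : Set where
  field
    shape-sym   : ∀ i → swapStep (lookup s (opposite i)) ≡ lookup s i
    filling-sym : ∀ i j → swapContent (at f (opposite j) (opposite i)) ≡ at f i j

at-tabulate : ∀ {n} (F : Fin n → Fin n → Content) p q →
              at (tabulate (λ p → tabulate (λ q → F p q))) p q ≡ F p q
at-tabulate F p q = trans (cong (λ r → lookup r q) (lookup∘tabulate _ p)) (lookup∘tabulate _ q)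

filling-ext : ∀ {n} (F : Fin n → Fin n → Content) (f : Filling n) → (∀ p q → F p q ≡ at f p q) →
              tabulate (λ p → tabulate (λ q → F p q)) ≡ f
filling-ext F f h = trans (tabulate-cong (λ p → trans (tabulate-cong (h p)) (tabulate∘lookup (lookup f p))))
                          (tabulate∘lookup f)

module _ {n : ℕ} (s : Shape n) (f : Filling n) where
  open Valid
  open Symmetric

  private
    cellsᵇ leftsᵇ upsᵇ : Fin n → Fin n → Bool
    cellsᵇ p q = not (isCell s p q) ⇒ᵇ isEmpty (at f p q)
    leftsᵇ p q = isLeft (at f p q) ⇒ᵇ
      ∀Fin n (λ q' → ((toℕ q <ᵇ toℕ q') ∧ isCell s p q') ⇒ᵇ isEmpty (at f p q'))
    upsᵇ p q = isUp (at f p q) ⇒ᵇ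
      ∀Fin n (λ p' → ((toℕ p' <ᵇ toℕ p) ∧ isCell s p' q) ⇒ᵇ isEmpty (at f p' q))

    gridᵇ : (Fin n → Fin n → Bool) → Bool
    gridᵇ P = ∀Fin n (λ p → ∀Fin n (P p))

    grid-elim : ∀ P → gridᵇ P ≡ true → ∀ p q → P p q ≡ true
    grid-elim P g p q = ∀Fin-elim n _ (∀Fin-elim n _ g p) q

    grid-intro : ∀ P → (∀ p q → P p q ≡ true) → gridᵇ P ≡ true
    grid-intro P h = ∀Fin-intro n _ λ p → ∀Fin-intro n _ (h p)

  alternative⇒valid : T (isAlternative (s , f)) → Valid s f
  alternative⇒valid h = record
    { outside-empty = λ p q c → isEmpty-elim (⇒ᵇ-elim _ (cells p q) (not-intro c))
    ; left-clear = λ p q q' l lt c → isEmpty-elim (⇒ᵇ-elim _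
        (∀Fin-elim n _ (⇒ᵇ-elim _ (lefts p q) (isLeft-intro l)) q') (∧-true (<ᵇ-intro lt) c))
    ; up-clear = λ p q p' u lt c → isEmpty-elim (⇒ᵇ-elim _
        (∀Fin-elim n _ (⇒ᵇ-elim _ (ups p q) (isUp-intro u)) p') (∧-true (<ᵇ-intro lt) c))
    }
    where
    cells : ∀ p q → cellsᵇ p q ≡ true
    cells = grid-elim cellsᵇ (∧-trueˡ (gridᵇ cellsᵇ) (T⇒≡ h))
    lefts : ∀ p q → leftsᵇ p q ≡ true
    lefts = grid-elim leftsᵇ (∧-trueˡ (gridᵇ leftsᵇ) (∧-trueʳ (gridᵇ cellsᵇ) (T⇒≡ h)))
    ups : ∀ p q → upsᵇ p q ≡ true
    ups = grid-elim upsᵇ (∧-trueʳ (gridᵇ leftsᵇ) (∧-trueʳ (gridᵇ cellsᵇ) (T⇒≡ h)))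

  valid⇒alternative : Valid s f → T (isAlternative (s , f))
  valid⇒alternative v =
    ≡⇒T (∧-true (grid-intro cellsᵇ cells) (∧-true (grid-intro leftsᵇ lefts) (grid-intro upsᵇ ups)))
    where
    cells : ∀ p q → cellsᵇ p q ≡ true
    cells p q = ⇒ᵇ-intro _ λ c → isEmpty-intro (outside-empty v p q (not-elim c))
    lefts : ∀ p q → leftsᵇ p q ≡ true
    lefts p q = ⇒ᵇ-intro _ λ l → ∀Fin-intro n _ λ q' → ⇒ᵇ-intro _ λ c →
      isEmpty-intro (left-clear v p q q' (isLeft-elim l) (<ᵇ-elim (∧-trueˡ (toℕ q <ᵇ toℕ q') c))
                                         (∧-trueʳ (toℕ q <ᵇ toℕ q') c))
    ups : ∀ p q → upsᵇ p q ≡ true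
    ups p q = ⇒ᵇ-intro _ λ u → ∀Fin-intro n _ λ p' → ⇒ᵇ-intro _ λ c →
      isEmpty-intro (up-clear v p q p' (isUp-elim u) (<ᵇ-elim (∧-trueˡ (toℕ p' <ᵇ toℕ p) c))
                                       (∧-trueʳ (toℕ p' <ᵇ toℕ p) c))

  transpose⇒symmetric : transpose (s , f) ≡ (s , f) → Symmetric s f
  transpose⇒symmetric e = record
    { shape-sym = λ i → trans (sym (lookup∘tabulate _ i)) (cong (λ v → lookup v i) (cong proj₁ e))
    ; filling-sym = λ i j → trans (sym (at-tabulate _ i j)) (cong (λ v → at v i j) (cong proj₂ e))
    }

  symmetric⇒transpose : Symmetric s f → transpose (s , f) ≡ (s , f)
  symmetric⇒transpose σ = cong₂ _,_ (trans (tabulate-cong (shape-sym σ)) (tabulate∘lookup s))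
                                    (filling-ext _ f (filling-sym σ))

-- Positions on a border of length m+2: the first step, a middle step
-- mid i coming from the inner border of length m, and the final step.
mid : ∀ {m} → Fin m → Fin (suc (suc m))
mid i = suc (inject₁ i)

final : ∀ {m} → Fin (suc (suc m))
final {m} = suc (fromℕ m)

data Position {m} : Fin (suc (suc m)) → Set where
  first  : Position zero
  middle : (i : Fin m) → Position (mid i)
  last   : Position final

position : ∀ {m} (k : Fin (suc (suc m))) → Position k
position zero = first
position (suc k) with Top.view k
... | Top.‵fromℕ = last
... | Top.‵inject₁ i = middle i

snoc : ∀ {m} {X : Set} → (Fin m → X) → X → Fin (suc m) → X
snoc {zero} g z zero = z
snoc {suc m} g z zero = g zero
snoc {suc m} g z (suc k) = snoc (g ∘ suc) z k

snoc-inject₁ : ∀ {m} {X : Set} (g : Fin m → X) z i → snoc g z (inject₁ i) ≡ g i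
snoc-inject₁ {suc m} g z zero = refl
snoc-inject₁ {suc m} g z (suc i) = snoc-inject₁ (g ∘ suc) z i

snoc-fromℕ : ∀ {m} {X : Set} (g : Fin m → X) z → snoc g z (fromℕ m) ≡ z
snoc-fromℕ {zero} g z = refl
snoc-fromℕ {suc m} g z = snoc-fromℕ (g ∘ suc) z

frame : ∀ {m} {X : Set} → X → (Fin m → X) → X → Fin (suc (suc m)) → X
frame a g z zero = a
frame a g z (suc k) = snoc g z k

frame-mid : ∀ {m} {X : Set} (a : X) (g : Fin m → X) z i → frame a g z (mid i) ≡ g i
frame-mid a g z i = snoc-inject₁ g z i

frame-final : ∀ {m} {X : Set} (a : X) (g : Fin m → X) z → frame a g z (final {m}) ≡ z
frame-final a g z = snoc-fromℕ g z

∀Fin-positions : ∀ m (P : Fin (suc (suc m)) → Bool) →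
                 ∀Fin (suc (suc m)) P ≡ P zero ∧ ∀Fin m (P ∘ mid) ∧ P final
∀Fin-positions m P = bool-ext
  (λ h → ∧-true (∀Fin-elim _ P h zero)
                (∧-true (∀Fin-intro m _ (λ i → ∀Fin-elim _ P h (mid i))) (∀Fin-elim _ P h final)))
  (λ h → ∀Fin-intro _ P λ k → at-position k h)
  where
  at-position : ∀ k → (P zero ∧ ∀Fin m (P ∘ mid) ∧ P final) ≡ true → P k ≡ true
  at-position k h with position k
  ... | first = ∧-trueˡ (P zero) h
  ... | middle i = ∀Fin-elim m _ (∧-trueˡ (∀Fin m (P ∘ mid)) (∧-trueʳ (P zero) h)) i
  ... | last = ∧-trueʳ (∀Fin m (P ∘ mid)) (∧-trueʳ (P zero) h)

#Fin-positions : ∀ m (P : Fin (suc (suc m)) → Bool) →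
                 #Fin (suc (suc m)) P ≡ ⟦ P zero ⟧ + #Fin m (P ∘ mid) + ⟦ P final ⟧
#Fin-positions m P = trans (cong (⟦ P zero ⟧ +_) (#Fin-snoc m (P ∘ suc))) (sym (ℕP.+-assoc ⟦ P zero ⟧ _ _))

opposite-inject₁ : ∀ {k} (i : Fin k) → opposite {suc k} (inject₁ i) ≡ suc (opposite i)
opposite-inject₁ {suc k} zero = refl
opposite-inject₁ {suc k} (suc i) = cong inject₁ (opposite-inject₁ i)

opposite-fromℕ : ∀ m → opposite {suc m} (fromℕ m) ≡ zero
opposite-fromℕ zero = refl
opposite-fromℕ (suc m) = cong inject₁ (opposite-fromℕ m)

opposite-mid : ∀ {m} (i : Fin m) → opposite (mid i) ≡ mid (opposite i)
opposite-mid i = cong inject₁ (opposite-inject₁ i)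

opposite-final : ∀ m → opposite (final {m}) ≡ zero
opposite-final m = cong inject₁ (opposite-fromℕ m)

opposite-< : ∀ {m} (i j : Fin m) → toℕ i < toℕ j → toℕ (opposite j) < toℕ (opposite i)
opposite-< {m} i j lt rewrite FP.opposite-prop i | FP.opposite-prop j =
  ℕP.∸-monoʳ-< (s≤s lt) (FP.toℕ<n j)

mid-<⁻¹ : ∀ {m} (i j : Fin m) → toℕ (mid i) < toℕ (mid j) → toℕ i < toℕ j
mid-<⁻¹ i j lt rewrite FP.toℕ-inject₁ i | FP.toℕ-inject₁ j = ℕP.≤-pred lt

mid-< : ∀ {m} (i j : Fin m) → toℕ i < toℕ j → toℕ (mid i) < toℕ (mid j)
mid-< i j lt rewrite FP.toℕ-inject₁ i | FP.toℕ-inject₁ j = s≤s lt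

final-maximal : ∀ {m} (q : Fin (suc (suc m))) → ¬ (toℕ (final {m}) < toℕ q)
final-maximal {m} q lt =
  ℕP.<⇒≱ lt (subst (λ k → toℕ q ≤ suc k) (sym (FP.toℕ-fromℕ m)) (ℕP.≤-pred (FP.toℕ<n q)))

-- Cells of a shape of length m+2 in terms of its steps.  (Cells in the
-- first column and in the final row do not exist, definitionally resp.
-- by isCell-final.)
module _ {m} (s : Shape (suc (suc m))) where

  isCell-mid : ∀ i j → isCell s (mid i) (mid j)
                       ≡ (toℕ i <ᵇ toℕ j) ∧ isSouth (lookup s (mid i)) ∧ isWest (lookup s (mid j))
  isCell-mid i j rewrite FP.toℕ-inject₁ i | FP.toℕ-inject₁ j = refl

  isCell-mid-final : ∀ i → isCell s (mid i) final ≡ isSouth (lookup s (mid i)) ∧ isWest (lookup s final)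
  isCell-mid-final i rewrite FP.toℕ-inject₁ i | FP.toℕ-fromℕ m | <ᵇ-intro (FP.toℕ<n i) = refl

  isCell-final : ∀ q → isCell s final q ≡ false
  isCell-final zero = refl
  isCell-final (suc q) rewrite FP.toℕ-fromℕ m | <ᵇ-false (ℕP.≤⇒≯ (ℕP.≤-pred (FP.toℕ<n q))) = refl

swapStep-involutive : ∀ x → swapStep (swapStep x) ≡ x
swapStep-involutive south = refl
swapStep-involutive west = refl

swapContent-involutive : ∀ c → swapContent (swapContent c) ≡ c
swapContent-involutive empty = refl
swapContent-involutive left = refl
swapContent-involutive up = refl

-- An entry fixed by swapContent is empty (diagonal cells carry no arrow).
swapContent-fixed : ∀ c → swapContent c ≡ c → c ≡ empty
swapContent-fixed empty _ = refl

swapContent-up : ∀ c → swapContent c ≡ up → c ≡ left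
swapContent-up left _ = refl

isWest-elim : ∀ {x} → isWest x ≡ true → x ≡ west
isWest-elim {west} _ = refl

isSouth-elim : ∀ {x} → isSouth x ≡ true → x ≡ south
isSouth-elim {south} _ = refl

empty≢left : empty ≡ left → ⊥
empty≢left ()

empty≢up : empty ≡ up → ⊥
empty≢up ()

left≢up : left ≡ up → ⊥
left≢up ()

none : ∀ {m} → Vec Bool m → Bool
none {m} S = ∀Fin m (λ j → not (lookup S j))

_⊆ᵇ_ : ∀ {m} → Vec Bool m → (Fin m → Bool) → Bool
_⊆ᵇ_ {m} S M = ∀Fin m (λ j → lookup S j ⇒ᵇ M j)

⊆ᵇ-elim : ∀ {m} (S : Vec Bool m) M j → (S ⊆ᵇ M) ≡ true → lookup S j ≡ true → M j ≡ true
⊆ᵇ-elim {m} S M j h e = ⇒ᵇ-elim _ (∀Fin-elim m _ h j) e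

none-elim : ∀ {m} (S : Vec Bool m) → none S ≡ true → ∀ j → lookup S j ≡ false
none-elim {m} S h j = not-elim (∀Fin-elim m _ h j)

none-false : ∀ {m} (S : Vec Bool m) j → lookup S j ≡ true → none S ≡ false
none-false S j e with none S in n
... | false = refl
... | true = ⊥-elim (true≢false (trans (sym e) (none-elim S n j)))

-- markLast S is the singleton of the largest element of S (empty if S is).
markLast : ∀ {m} → Vec Bool m → Vec Bool m
markLast [] = []
markLast (x ∷ xs) = (x ∧ none xs) ∷ markLast xs

markLast-elim : ∀ {m} (S : Vec Bool m) j → lookup (markLast S) j ≡ true →
                lookup S j ≡ true × (∀ j' → toℕ j < toℕ j' → lookup S j' ≡ false)
markLast-elim (x ∷ xs) zero h =
  ∧-trueˡ x h , λ { zero () ; (suc j') _ → none-elim xs (∧-trueʳ x h) j' }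
markLast-elim (x ∷ xs) (suc j) h = let (a , b) = markLast-elim xs j h in
  a , λ { zero () ; (suc j') (s≤s lt) → b j' lt }

markLast-intro : ∀ {m} (S : Vec Bool m) j → lookup S j ≡ true →
                 (∀ j' → toℕ j < toℕ j' → lookup S j' ≡ false) → lookup (markLast S) j ≡ true
markLast-intro (x ∷ xs) zero e h = ∧-true e (∀Fin-intro _ _ λ j' → not-intro (h (suc j') (s≤s z≤n)))
markLast-intro (x ∷ xs) (suc j) e h = markLast-intro xs j e λ j' lt → h (suc j') (s≤s lt)

markLast-exists : ∀ {m} (S : Vec Bool m) → none S ≡ false → Σ (Fin m) λ j → lookup (markLast S) j ≡ true
markLast-exists (x ∷ xs) h with none xs in e
... | false = let (j , p) = markLast-exists xs e in suc j , p
... | true with x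
...   | true = zero , refl
...   | false = ⊥-elim (true≢false h)

markLast-count : ∀ {m} (S : Vec Bool m) (M : Fin m → Bool) → (S ⊆ᵇ M) ≡ true →
  #Fin m (λ j → M j ∧ (not (lookup S j) ∨ lookup (markLast S) j))
    ≡ #Fin m (λ j → M j ∧ not (lookup S j)) + ⟦ not (none S) ⟧
markLast-count [] M ok = refl
markLast-count {suc m} (false ∷ xs) M ok =
  trans (cong (⟦ M zero ∧ true ⟧ +_) (markLast-count xs (M ∘ suc) (∧-trueʳ (false ⇒ᵇ M zero) ok)))
        (sym (ℕP.+-assoc ⟦ M zero ∧ true ⟧ _ _))
markLast-count {suc m} (true ∷ xs) M ok with M zero | ∧-trueˡ (true ⇒ᵇ M zero) ok
... | true | refl = trans (cong (⟦ none xs ⟧ +_) (markLast-count xs (M ∘ suc) (∧-trueʳ (M zero) ok)))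
                          (rearrange (none xs))
  where
  X : ℕ
  X = #Fin m (λ j → M (suc j) ∧ not (lookup xs j))
  rearrange : ∀ y → ⟦ y ⟧ + (X + ⟦ not y ⟧) ≡ X + 1
  rearrange true = trans (cong suc (ℕP.+-identityʳ X)) (ℕP.+-comm 1 X)
  rearrange false = refl

Raw : ℕ → Set
Raw m = Shape m × Filling m

isFree : ∀ {m} → Raw m → Fin m → Bool
isFree {m} (s , f) q = isWest (lookup s q) ∧ ∀Fin m (λ p → not (isUp (at f p q)))

#free : ∀ {m} → Raw m → ℕ
#free {m} x = #Fin m (isFree x)

topRow : ∀ {m} → Bool → Vec Bool m → Fin m → Content
topRow b S j = if lookup S j then (if b ∧ lookup (markLast S) j then left else up) else empty

firstStep : ∀ {m} → Bool → Vec Bool m → Step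
firstStep b S = if b ∧ none S then west else south

finalColumn : ∀ {m} → Bool → Vec Bool m → Fin m → Content
finalColumn b S i = swapContent (topRow b S (opposite i))

layerShape : ∀ {m} → Bool → Shape m → Vec Bool m → Fin (suc (suc m)) → Step
layerShape b s S = frame (firstStep b S) (lookup s) (swapStep (firstStep b S))

layerFilling : ∀ {m} → Bool → Filling m → Vec Bool m → Fin (suc (suc m)) → Fin (suc (suc m)) → Content
layerFilling b f S p q =
  frame (frame empty (topRow b S) empty q) (λ i → frame empty (λ j → at f i j) (finalColumn b S i) q) empty p

addLayer : ∀ {m} → Bool → Raw m → Vec Bool m → Raw (suc (suc m))
addLayer b (s , f) S = tabulate (layerShape b s S) , tabulate (λ p → tabulate (λ q → layerFilling b f S p q))

topRow-outside : ∀ {m} b (S : Vec Bool m) j → lookup S j ≡ false → topRow b S j ≡ empty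
topRow-outside b S j e rewrite e = refl

topRow-left : ∀ {m} b (S : Vec Bool m) j → topRow b S j ≡ left → b ∧ lookup (markLast S) j ≡ true
topRow-left b S j h with lookup S j | b ∧ lookup (markLast S) j
... | true | true = refl
... | true | false = ⊥-elim (left≢up (sym h))
... | false | _ = ⊥-elim (empty≢left h)

firstStep-south : ∀ {m} b (S : Vec Bool m) j → lookup S j ≡ true → firstStep b S ≡ south
firstStep-south b S j e rewrite none-false S j e | ∧-zeroʳ b = refl

topRow-after-left : ∀ {m} b (S : Vec Bool m) j j' → topRow b S j ≡ left → toℕ j < toℕ j' → lookup S j' ≡ false
topRow-after-left b S j j' l lt = proj₂ (markLast-elim S j (∧-trueʳ b (topRow-left b S j l))) j' lt

module AddLayer {m} (b : Bool) (s : Shape m) (f : Filling m) (S : Vec Bool m) where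

  s' : Shape (suc (suc m))
  s' = proj₁ (addLayer b (s , f) S)

  f' : Filling (suc (suc m))
  f' = proj₂ (addLayer b (s , f) S)

  F : Fin (suc (suc m)) → Fin (suc (suc m)) → Content
  F = layerFilling b f S

  private
    h : Step
    h = firstStep b S

    row : Fin (suc (suc m)) → Fin m → Content
    row q i = frame empty (λ j → at f i j) (finalColumn b S i) q

    topRowFrame : Fin (suc (suc m)) → Content
    topRowFrame q = frame empty (topRow b S) empty q

  shape-mid : ∀ i → lookup s' (mid i) ≡ lookup s i
  shape-mid i = trans (lookup∘tabulate (layerShape b s S) (mid i)) (frame-mid h (lookup s) (swapStep h) i)

  shape-final : lookup s' final ≡ swapStep (firstStep b S)
  shape-final = trans (lookup∘tabulate (layerShape b s S) final) (frame-final h (lookup s) (swapStep h))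

  entry : ∀ p q → at f' p q ≡ F p q
  entry = at-tabulate F

  F-first-mid : ∀ j → F zero (mid j) ≡ topRow b S j
  F-first-mid j = frame-mid empty (topRow b S) empty j

  F-first-final : F zero final ≡ empty
  F-first-final = frame-final empty (topRow b S) empty

  F-mid-first : ∀ i → F (mid i) zero ≡ empty
  F-mid-first i = frame-mid (topRowFrame zero) (row zero) empty i

  F-mid : ∀ i j → F (mid i) (mid j) ≡ at f i j
  F-mid i j = trans (frame-mid (topRowFrame (mid j)) (row (mid j)) empty i)
                    (frame-mid empty (λ j → at f i j) (finalColumn b S i) j)

  F-mid-final : ∀ i → F (mid i) final ≡ finalColumn b S i
  F-mid-final i = trans (frame-mid (topRowFrame final) (row final) empty i)
                        (frame-final empty (λ j → at f i j) (finalColumn b S i))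

  F-final : ∀ q → F final q ≡ empty
  F-final q = frame-final (topRowFrame q) (row q) empty

  isCell-mid-mid : ∀ i j → isCell s' (mid i) (mid j) ≡ isCell s i j
  isCell-mid-mid i j = trans (isCell-mid s' i j)
    (cong₂ (λ x y → (toℕ i <ᵇ toℕ j) ∧ isSouth x ∧ isWest y) (shape-mid i) (shape-mid j))

module AddLayerPreserves {m} (b : Bool) (s : Shape m) (f : Filling m) (S : Vec Bool m)
  (v : Valid s f) (σ : Symmetric s f) (S-free : (S ⊆ᵇ isFree (s , f)) ≡ true) where
  open AddLayer b s f S
  open Valid v
  open Symmetric σ

  S-column : ∀ j → lookup S j ≡ true → isWest (lookup s j) ≡ true
  S-column j e = ∧-trueˡ _ (⊆ᵇ-elim S (isFree (s , f)) j S-free e)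

  up⇒∉S : ∀ p j → at f p j ≡ up → lookup S j ≡ false
  up⇒∉S p j u = contraposeᵇ noUp (cong (not ∘ isUp) u)
    where
    noUp : lookup S j ≡ true → not (isUp (at f p j)) ≡ true
    noUp e = ∀Fin-elim m _ (∧-trueʳ (isWest (lookup s j)) (⊆ᵇ-elim S (isFree (s , f)) j S-free e)) p

  finalColumn-outside : ∀ i → lookup S (opposite i) ≡ false → finalColumn b S i ≡ empty
  finalColumn-outside i e = cong swapContent (topRow-outside b S (opposite i) e)

  first-mid-cell : ∀ j → lookup S j ≡ true → isCell s' zero (mid j) ≡ true
  first-mid-cell j e =
    ∧-true (cong isSouth (firstStep-south b S j e)) (trans (cong isWest (shape-mid j)) (S-column j e))

  mid-final-cell : ∀ i → lookup S (opposite i) ≡ true → isCell s' (mid i) final ≡ true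
  mid-final-cell i e = trans (isCell-mid-final s' i) (∧-true row-south column-west)
    where
    row-south : isSouth (lookup s' (mid i)) ≡ true
    row-south = cong isSouth (begin
      lookup s' (mid i)                    ≡⟨ shape-mid i ⟩
      lookup s i                           ≡⟨ shape-sym i ⟨
      swapStep (lookup s (opposite i))     ≡⟨ cong swapStep (isWest-elim (S-column (opposite i) e)) ⟩
      south                                ∎)
      where open ≡-Reasoning
    column-west : isWest (lookup s' final) ≡ true
    column-west = trans (cong isWest shape-final) (cong (isWest ∘ swapStep) (firstStep-south b S _ e))

  outside-empty' : ∀ p q → isCell s' p q ≡ false → F p q ≡ empty
  outside-empty' p q c with position p | position q
  ... | first | first = refl
  ... | first | middle j = trans (F-first-mid j) (topRow-outside b S j (contraposeᵇ (first-mid-cell j) c))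
  ... | first | last = F-first-final
  ... | middle i | first = F-mid-first i
  ... | middle i | middle j = trans (F-mid i j) (outside-empty i j (trans (sym (isCell-mid-mid i j)) c))
  ... | middle i | last = trans (F-mid-final i) (finalColumn-outside i (contraposeᵇ (mid-final-cell i) c))
  ... | last | _ = F-final q

  left-clear' : ∀ p q q' → F p q ≡ left → toℕ q < toℕ q' → isCell s' p q' ≡ true → F p q' ≡ empty
  left-clear' p q q' l lt c with position p | position q | position q'
  ... | first | first | _ = ⊥-elim (empty≢left l)
  ... | first | middle j | first = ⊥-elim (ℕP.n≮0 lt)
  ... | first | middle j | middle j' = trans (F-first-mid j')
        (topRow-outside b S j' (topRow-after-left b S j j' (trans (sym (F-first-mid j)) l) (mid-<⁻¹ j j' lt)))
  ... | first | middle j | last = F-first-final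
  ... | first | last | _ = ⊥-elim (empty≢left (trans (sym F-first-final) l))
  ... | middle i | first | _ = ⊥-elim (empty≢left (trans (sym (F-mid-first i)) l))
  ... | middle i | middle j | first = ⊥-elim (ℕP.n≮0 lt)
  ... | middle i | middle j | middle j' = trans (F-mid i j')
        (left-clear i j j' (trans (sym (F-mid i j)) l) (mid-<⁻¹ j j' lt) (trans (sym (isCell-mid-mid i j')) c))
  ... | middle i | middle j | last =
        trans (F-mid-final i) (finalColumn-outside i (up⇒∉S (opposite j) (opposite i) mirror-up))
    where
    -- the mirror image of the left arrow in cell (i , j) is an up arrow
    mirror-up : at f (opposite j) (opposite i) ≡ up
    mirror-up = trans (sym (filling-sym (opposite j) (opposite i))) (cong swapContent
      (trans (cong₂ (at f) (FP.opposite-involutive i) (FP.opposite-involutive j)) (trans (sym (F-mid i j)) l)))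
  ... | middle i | last | _ = ⊥-elim (final-maximal q' lt)
  ... | last | _ | _ = ⊥-elim (empty≢left (trans (sym (F-final q)) l))

  up-clear' : ∀ p q p' → F p q ≡ up → toℕ p' < toℕ p → isCell s' p' q ≡ true → F p' q ≡ empty
  up-clear' p q p' u lt c with position p | position q | position p'
  ... | first | _ | _ = ⊥-elim (ℕP.n≮0 lt)
  ... | middle i | first | _ = ⊥-elim (empty≢up (trans (sym (F-mid-first i)) u))
  ... | middle i | middle j | first =
        trans (F-first-mid j) (topRow-outside b S j (up⇒∉S i j (trans (sym (F-mid i j)) u)))
  ... | middle i | middle j | middle i' = trans (F-mid i' j)
        (up-clear i j i' (trans (sym (F-mid i j)) u) (mid-<⁻¹ i' i lt) (trans (sym (isCell-mid-mid i' j)) c))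
  ... | middle i | middle j | last = ⊥-elim (final-maximal (mid i) lt)
  ... | middle i | last | first = F-first-final
  ... | middle i | last | middle i' = trans (F-mid-final i') (finalColumn-outside i'
        (topRow-after-left b S (opposite i) (opposite i')
          (swapContent-up _ (trans (sym (F-mid-final i)) u)) (opposite-< i' i (mid-<⁻¹ i' i lt))))
  ... | middle i | last | last = ⊥-elim (final-maximal (mid i) lt)
  ... | last | _ | _ = ⊥-elim (empty≢up (trans (sym (F-final q)) u))

  valid : Valid s' f'
  valid = record
    { outside-empty = λ p q c → trans (entry p q) (outside-empty' p q c)
    ; left-clear = λ p q q' l lt c →
        trans (entry p q') (left-clear' p q q' (trans (sym (entry p q)) l) lt c)
    ; up-clear = λ p q p' u lt c →
        trans (entry p' q) (up-clear' p q p' (trans (sym (entry p q)) u) lt c)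
    }

  shape-sym' : ∀ k → swapStep (lookup s' (opposite k)) ≡ lookup s' k
  shape-sym' k with position k
  ... | first = trans (cong swapStep shape-final) (swapStep-involutive _)
  ... | middle i = trans (cong (swapStep ∘ lookup s') (opposite-mid i))
        (trans (cong swapStep (shape-mid (opposite i))) (trans (shape-sym i) (sym (shape-mid i))))
  ... | last = trans (cong (swapStep ∘ lookup s') (opposite-final m)) (sym shape-final)

  filling-sym' : ∀ k l → swapContent (F (opposite l) (opposite k)) ≡ F k l
  filling-sym' k l with position k | position l
  ... | first | first = cong swapContent (F-final final)
  ... | first | middle j = trans (cong (λ z → swapContent (F z final)) (opposite-mid j))
        (trans (cong swapContent (F-mid-final (opposite j)))
        (trans (swapContent-involutive _)
        (trans (cong (topRow b S) (FP.opposite-involutive j)) (sym (F-first-mid j)))))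
  ... | first | last = trans (cong (λ z → swapContent (F z final)) (opposite-final m))
        (trans (cong swapContent F-first-final) (sym F-first-final))
  ... | middle i | first = trans (cong swapContent (F-final (opposite (mid i)))) (sym (F-mid-first i))
  ... | middle i | middle j = trans (cong₂ (λ y z → swapContent (F y z)) (opposite-mid j) (opposite-mid i))
        (trans (cong swapContent (F-mid (opposite j) (opposite i))) (trans (filling-sym i j) (sym (F-mid i j))))
  ... | middle i | last = trans (cong₂ (λ y z → swapContent (F y z)) (opposite-final m) (opposite-mid i))
        (trans (cong swapContent (F-first-mid (opposite i))) (sym (F-mid-final i)))
  ... | last | first = trans (cong swapContent (F-final (opposite final))) (sym (F-final zero))
  ... | last | middle j = trans (cong₂ (λ y z → swapContent (F y z)) (opposite-mid j) (opposite-final m))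
        (trans (cong swapContent (F-mid-first (opposite j))) (sym (F-final (mid j))))
  ... | last | last = trans (cong₂ (λ y z → swapContent (F y z)) (opposite-final m) (opposite-final m))
        (sym (F-final final))

  symmetric : Symmetric s' f'
  symmetric = record
    { shape-sym = shape-sym'
    ; filling-sym = λ k l → trans (cong swapContent (entry (opposite l) (opposite k)))
                                  (trans (filling-sym' k l) (sym (entry k l)))
    }

innerShape : ∀ {m} → Shape (suc (suc m)) → Shape m
innerShape s' = tabulate (λ i → lookup s' (mid i))

innerFilling : ∀ {m} → Filling (suc (suc m)) → Filling m
innerFilling f' = tabulate (λ i → tabulate (λ j → at f' (mid i) (mid j)))

noLeftInTopRow : ∀ {m} → Filling (suc (suc m)) → Bool
noLeftInTopRow {m} f' = ∀Fin m (λ j → not (isLeft (at f' zero (mid j))))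

layerBit : ∀ {m} → Raw (suc (suc m)) → Bool
layerBit (s' , f') = isWest (lookup s' zero) ∨ not (noLeftInTopRow f')

topRowSet : ∀ {m} → Raw (suc (suc m)) → Vec Bool m
topRowSet (s' , f') = tabulate (λ j → not (isEmpty (at f' zero (mid j))))

peelLayer : ∀ {m} → Raw (suc (suc m)) → Bool × Raw m × Vec Bool m
peelLayer x'@(s' , f') = layerBit x' , (innerShape s' , innerFilling f') , topRowSet x'

module PeelLayer {m} (s' : Shape (suc (suc m))) (f' : Filling (suc (suc m)))
  (v' : Valid s' f') (σ' : Symmetric s' f') where
  open Valid v'
  open Symmetric σ'

  s : Shape m
  s = innerShape s'

  f : Filling m
  f = innerFilling f'

  S : Vec Bool m
  S = topRowSet (s' , f')

  b : Bool
  b = layerBit (s' , f')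

  h : Step
  h = lookup s' zero

  top : Fin m → Content
  top j = at f' zero (mid j)

  inner-step : ∀ i → lookup s i ≡ lookup s' (mid i)
  inner-step i = lookup∘tabulate _ i

  inner-entry : ∀ i j → at f i j ≡ at f' (mid i) (mid j)
  inner-entry i j = at-tabulate (λ i j → at f' (mid i) (mid j)) i j

  S-top : ∀ j → lookup S j ≡ not (isEmpty (top j))
  S-top j = lookup∘tabulate _ j

  inner-isCell : ∀ i j → isCell s' (mid i) (mid j) ≡ isCell s i j
  inner-isCell i j = trans (isCell-mid s' i j)
    (cong₂ (λ x y → (toℕ i <ᵇ toℕ j) ∧ isSouth x ∧ isWest y) (sym (inner-step i)) (sym (inner-step j)))

  inner-valid : Valid s f
  inner-valid = record
    { outside-empty = λ i j c → trans (inner-entry i j) (outside-empty (mid i) (mid j) (trans (inner-isCell i j) c))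
    ; left-clear = λ i j j' l lt c → trans (inner-entry i j')
        (left-clear (mid i) (mid j) (mid j') (trans (sym (inner-entry i j)) l) (mid-< j j' lt) (trans (inner-isCell i j') c))
    ; up-clear = λ i j i' u lt c → trans (inner-entry i' j)
        (up-clear (mid i) (mid j) (mid i') (trans (sym (inner-entry i j)) u) (mid-< i' i lt) (trans (inner-isCell i' j) c))
    }

  inner-symmetric : Symmetric s f
  inner-symmetric = record
    { shape-sym = λ i → trans (cong swapStep (trans (inner-step (opposite i)) (cong (lookup s') (sym (opposite-mid i)))))
                              (trans (shape-sym (mid i)) (sym (inner-step i)))
    ; filling-sym = λ i j → trans (cong swapContent (trans (inner-entry (opposite j) (opposite i))
                                    (sym (cong₂ (at f') (opposite-mid j) (opposite-mid i)))))
                                  (trans (filling-sym (mid i) (mid j)) (sym (inner-entry i j)))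
    }

  empty-if-cell : ∀ p q → (isCell s' p q ≡ true → at f' p q ≡ empty) → at f' p q ≡ empty
  empty-if-cell p q k with isCell s' p q in e
  ... | true = k refl
  ... | false = outside-empty p q e

  nonempty⇒∈S : ∀ j c → top j ≡ c → isEmpty c ≡ false → lookup S j ≡ true
  nonempty⇒∈S j c e ne = trans (S-top j) (trans (cong (not ∘ isEmpty) e) (cong not ne))

  ∈S⇒cell : ∀ j → lookup S j ≡ true → isCell s' zero (mid j) ≡ true
  ∈S⇒cell j e with isCell s' zero (mid j) in c
  ... | true = refl
  ... | false = ⊥-elim (true≢false (trans (sym e) (trans (S-top j) (cong (not ∘ isEmpty) (outside-empty zero (mid j) c)))))

  ∈S⇒south : ∀ j → lookup S j ≡ true → h ≡ south
  ∈S⇒south j e = isSouth-elim (∧-trueˡ (isSouth h) (∈S⇒cell j e))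

  -- S consists of free columns: a column with an up arrow below the top
  -- row has an empty top cell.
  S-free : (S ⊆ᵇ isFree (s , f)) ≡ true
  S-free = ∀Fin-intro m _ λ j → ⇒ᵇ-intro (lookup S j) λ e → ∧-true
    (trans (cong isWest (inner-step j)) (∧-trueʳ (isSouth h) (∈S⇒cell j e)))
    (∀Fin-intro m _ λ p → no-up p j e)
    where
    no-up : ∀ p j → lookup S j ≡ true → not (isUp (at f p j)) ≡ true
    no-up p j e with at f p j in u
    ... | empty = refl
    ... | left = refl
    ... | up = ⊥-elim (true≢false (trans (sym e) (trans (S-top j) (cong (not ∘ isEmpty)
                 (up-clear (mid p) (mid j) zero (trans (sym (inner-entry p j)) u) (s≤s z≤n) (∈S⇒cell j e))))))

  corner-empty : at f' zero final ≡ empty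
  corner-empty = swapContent-fixed _
    (trans (cong (λ z → swapContent (at f' z final)) (sym (opposite-final m))) (filling-sym zero final))

  first-column-empty : ∀ p → at f' p zero ≡ empty
  first-column-empty p = outside-empty p zero refl

  final-row-empty : ∀ q → at f' final q ≡ empty
  final-row-empty q = outside-empty final q (isCell-final s' q)

  final-column : ∀ i → at f' (mid i) final ≡ swapContent (top (opposite i))
  final-column i = trans (sym (filling-sym (mid i) final))
    (cong₂ (λ y z → swapContent (at f' y z)) (opposite-final m) (opposite-mid i))

  final-step : lookup s' final ≡ swapStep h
  final-step = trans (sym (shape-sym final)) (cong (swapStep ∘ lookup s') (opposite-final m))

  after-left : ∀ j → top j ≡ left → ∀ j' → toℕ j < toℕ j' → top j' ≡ empty
  after-left j l j' lt = empty-if-cell zero (mid j') (left-clear zero (mid j) (mid j') l (mid-< j j' lt))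

  b-left : ∀ j → top j ≡ left → b ≡ true
  b-left j l = trans (cong (λ z → isWest h ∨ not z) noLeft-false) (∨-zeroʳ _)
    where
    noLeft-false : noLeftInTopRow f' ≡ false
    noLeft-false = contraposeᵇ (λ e → ∀Fin-elim m _ e j) (cong (not ∘ isLeft) l)

  b-some-left : b ≡ true → h ≡ south → Σ (Fin m) (λ j → top j ≡ left)
  b-some-left bt eh =
    let (j , e) = ∀Fin-counterexample m _ noLeft-false in j , isLeft-elim (not≡false e)
    where
    noLeft-false : noLeftInTopRow f' ≡ false
    noLeft-false = not-elim (trans (sym (cong (λ z → isWest z ∨ not (noLeftInTopRow f')) eh)) bt)

  firstStep-peel : firstStep b S ≡ h
  firstStep-peel with h in eh
  ... | west = cong (λ x → if x then west else south) S-empty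
    where
    S-empty : none S ≡ true
    S-empty = ∀Fin-intro m _ λ j → not-intro (∉S j)
      where
      ∉S : ∀ j → lookup S j ≡ false
      ∉S j with lookup S j in e
      ... | false = refl
      ... | true = ⊥-elim (true≢false (cong isWest (trans (sym eh) (∈S⇒south j e))))
  ... | south with noLeftInTopRow f' in ea
  ...   | true = refl
  ...   | false = let (j , l) = ∀Fin-counterexample m _ ea in
          cong (λ x → if x then west else south) (none-false S j (nonempty⇒∈S j left (isLeft-elim (not≡false l)) refl))

  -- The top row is recovered: it has arrows exactly in S, and its left
  -- arrow, if any, is the last one and is present exactly when b holds.
  topRow-peel : ∀ j → topRow b S j ≡ top j
  topRow-peel j = by-content (top j) refl
    where
    arrow : Bool → Bool → Content
    arrow x y = if x then (if y then left else up) else empty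
    up-unmarked : top j ≡ up → b ∧ lookup (markLast S) j ≡ false
    up-unmarked u with b ∧ lookup (markLast S) j in bm
    ... | false = refl
    ... | true with b-some-left (∧-trueˡ b bm) (∈S⇒south j (nonempty⇒∈S j up u refl))
    ...   | j₂ , l₂ with ℕP.<-cmp (toℕ j) (toℕ j₂)
    ...     | tri< lt _ _ = ⊥-elim (true≢false (trans (sym (nonempty⇒∈S j₂ left l₂ refl))
                              (proj₂ (markLast-elim S j (∧-trueʳ b bm)) j₂ lt)))
    ...     | tri≈ _ eq _ = ⊥-elim (left≢up (trans (sym l₂) (trans (cong top (sym (FP.toℕ-injective eq))) u)))
    ...     | tri> _ _ gt = ⊥-elim (empty≢up (trans (sym (after-left j₂ l₂ j gt)) u))
    by-content : ∀ c → top j ≡ c → topRow b S j ≡ c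
    by-content empty e = topRow-outside b S j (trans (S-top j) (cong (not ∘ isEmpty) e))
    by-content left e = cong₂ arrow (nonempty⇒∈S j left e refl) (∧-true (b-left j e) marked)
      where
      marked : lookup (markLast S) j ≡ true
      marked = markLast-intro S j (nonempty⇒∈S j left e refl) λ j' lt →
               trans (S-top j') (cong (not ∘ isEmpty) (after-left j e j' lt))
    by-content up e = cong₂ arrow (nonempty⇒∈S j up e refl) (up-unmarked e)

  open AddLayer b s f S using (F-first-mid; F-first-final; F-mid-first; F-mid; F-mid-final; F-final)

  shape-peel : ∀ k → layerShape b s S k ≡ lookup s' k
  shape-peel k with position k
  ... | first = firstStep-peel
  ... | middle i = trans (frame-mid (firstStep b S) (lookup s) (swapStep (firstStep b S)) i) (inner-step i)
  ... | last = trans (frame-final (firstStep b S) (lookup s) (swapStep (firstStep b S)))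
                     (trans (cong swapStep firstStep-peel) (sym final-step))

  filling-peel : ∀ p q → layerFilling b f S p q ≡ at f' p q
  filling-peel p q with position p | position q
  ... | first | first = sym (first-column-empty zero)
  ... | first | middle j = trans (F-first-mid j) (topRow-peel j)
  ... | first | last = trans F-first-final (sym corner-empty)
  ... | middle i | first = trans (F-mid-first i) (sym (first-column-empty (mid i)))
  ... | middle i | middle j = trans (F-mid i j) (inner-entry i j)
  ... | middle i | last = trans (F-mid-final i)
          (trans (cong swapContent (topRow-peel (opposite i))) (sym (final-column i)))
  ... | last | _ = trans (F-final q) (sym (final-row-empty q))

  addLayer-peel : addLayer b (s , f) S ≡ (s' , f')
  addLayer-peel = cong₂ _,_ (trans (tabulate-cong shape-peel) (tabulate∘lookup s'))
                            (filling-ext _ f' filling-peel)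

module PeelAddLayer {m} (b : Bool) (s : Shape m) (f : Filling m) (S : Vec Bool m) where
  open AddLayer b s f S

  top-add : ∀ j → at f' zero (mid j) ≡ topRow b S j
  top-add j = trans (entry zero (mid j)) (F-first-mid j)

  topRowSet-add : topRowSet (s' , f') ≡ S
  topRowSet-add = trans (tabulate-cong (λ j → trans (cong (not ∘ isEmpty) (top-add j)) (arrow-iff-∈S j)))
                        (tabulate∘lookup S)
    where
    arrow-iff-∈S : ∀ j → not (isEmpty (topRow b S j)) ≡ lookup S j
    arrow-iff-∈S j with lookup S j | b ∧ lookup (markLast S) j
    ... | false | _ = refl
    ... | true | true = refl
    ... | true | false = refl

  innerShape-add : innerShape s' ≡ s
  innerShape-add = trans (tabulate-cong shape-mid) (tabulate∘lookup s)

  innerFilling-add : innerFilling f' ≡ f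
  innerFilling-add = filling-ext _ f (λ i j → trans (entry (mid i) (mid j)) (F-mid i j))

  noLeft-add : noLeftInTopRow f' ≡ ∀Fin m (λ j → not (isLeft (topRow b S j)))
  noLeft-add = ∀Fin-cong m (λ j → cong (not ∘ isLeft) (top-add j))

-- The bit is recovered: without b the top row has no left arrow and the
-- first step is south; with b, either the first step is west (S empty) or
-- the last column of S carries a left arrow.
layerBit-add : ∀ {m} b (s : Shape m) (f : Filling m) (S : Vec Bool m) → layerBit (addLayer b (s , f) S) ≡ b
layerBit-add {m} false s f S =
  cong not (trans (noLeft-add false s f S) (∀Fin-intro m _ never-left))
  where
  open PeelAddLayer
  never-left : ∀ j → not (isLeft (topRow false S j)) ≡ true
  never-left j with lookup S j
  ... | true = refl
  ... | false = refl
layerBit-add {m} true s f S with none S in e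
... | true = refl
... | false = cong not (trans (noLeft-add true s f S)
                             (contraposeᵇ (λ h → ∀Fin-elim m _ h j) (cong (not ∘ isLeft) last-left)))
  where
  open PeelAddLayer
  j : Fin m
  j = proj₁ (markLast-exists S e)
  marked : lookup (markLast S) j ≡ true
  marked = proj₂ (markLast-exists S e)
  last-left : topRow true S j ≡ left
  last-left = cong₂ (λ x y → if x then (if y then left else up) else empty)
                    (proj₁ (markLast-elim S j marked)) marked

peel-add : ∀ {m} b (s : Shape m) (f : Filling m) (S : Vec Bool m) → peelLayer (addLayer b (s , f) S) ≡ (b , (s , f) , S)
peel-add b s f S = cong₂ _,_ (layerBit-add b s f S) (cong₂ _,_ (cong₂ _,_ innerShape-add innerFilling-add) topRowSet-add)
  where open PeelAddLayer b s f S

-- The number of free columns of addLayer b (s , f) S, where M is the set of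
-- free columns of (s , f), read off from its first, middle and final
-- columns (see FreeColumns below).
layerCount : ∀ {m} → Bool → (Fin m → Bool) → Vec Bool m → ℕ
layerCount {m} b M S =
  ⟦ isWest (firstStep b S) ⟧ + #Fin m (λ j → M j ∧ not (isUp (topRow b S j)))
  + ⟦ isWest (swapStep (firstStep b S)) ∧ ∀Fin m (λ i → not (isUp (finalColumn b S i))) ⟧

-- In each case exactly one new free column appears: the final column
-- (b false), the first column (b true, S empty), or the column of the left
-- arrow (b true, S non-empty).
module _ {m} (M : Fin m → Bool) (S : Vec Bool m) where
  private
    X : ℕ
    X = #Fin m (λ j → M j ∧ not (lookup S j))

  layerCount-false : layerCount false M S ≡ suc X
  layerCount-false = trans (cong₂ (λ y z → y + ⟦ true ∧ z ⟧) (#Fin-cong m up-iff-∈S) (∀Fin-intro m _ no-up))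
                           (ℕP.+-comm X 1)
    where
    up-iff-∈S : ∀ j → M j ∧ not (isUp (topRow false S j)) ≡ M j ∧ not (lookup S j)
    up-iff-∈S j with lookup S j
    ... | true = refl
    ... | false = refl
    no-up : ∀ i → not (isUp (finalColumn false S i)) ≡ true
    no-up i with lookup S (opposite i)
    ... | true = refl
    ... | false = refl

  layerCount-empty : none S ≡ true → layerCount true M S ≡ suc X
  layerCount-empty e rewrite e = cong suc (trans (ℕP.+-identityʳ _) (#Fin-cong m no-arrows))
    where
    no-arrows : ∀ j → M j ∧ not (isUp (topRow true S j)) ≡ M j ∧ not (lookup S j)
    no-arrows j rewrite none-elim S e j = refl

  layerCount-nonempty : (S ⊆ᵇ M) ≡ true → none S ≡ false → layerCount true M S ≡ suc X
  layerCount-nonempty S⊆M e rewrite e = begin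
    #Fin m (λ j → M j ∧ not (isUp (topRow true S j))) + ⟦ ∀Fin m (λ i → not (isUp (finalColumn true S i))) ⟧
      ≡⟨ cong₂ (λ y z → y + ⟦ z ⟧) (#Fin-cong m up-iff-unmarked) final-not-free ⟩
    #Fin m (λ j → M j ∧ (not (lookup S j) ∨ lookup (markLast S) j)) + 0
      ≡⟨ ℕP.+-identityʳ _ ⟩
    #Fin m (λ j → M j ∧ (not (lookup S j) ∨ lookup (markLast S) j))
      ≡⟨ markLast-count S M S⊆M ⟩
    X + ⟦ not (none S) ⟧
      ≡⟨ cong (λ z → X + ⟦ not z ⟧) e ⟩
    X + 1
      ≡⟨ ℕP.+-comm X 1 ⟩
    suc X ∎
    where
    open ≡-Reasoning
    up-iff-unmarked : ∀ j → M j ∧ not (isUp (topRow true S j)) ≡ M j ∧ (not (lookup S j) ∨ lookup (markLast S) j)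
    up-iff-unmarked j with lookup S j | lookup (markLast S) j
    ... | true | true = refl
    ... | true | false = refl
    ... | false | true = refl
    ... | false | false = refl
    -- the mirror image of the left arrow is an up arrow in the final column
    j₀ : Fin m
    j₀ = proj₁ (markLast-exists S e)
    marked : lookup (markLast S) j₀ ≡ true
    marked = proj₂ (markLast-exists S e)
    mirror-up : finalColumn true S (opposite j₀) ≡ up
    mirror-up = cong swapContent (trans (cong (topRow true S) (FP.opposite-involutive j₀))
      (cong₂ (λ x y → if x then (if y then left else up) else empty) (proj₁ (markLast-elim S j₀ marked)) marked))
    final-not-free : ∀Fin m (λ i → not (isUp (finalColumn true S i))) ≡ false
    final-not-free = contraposeᵇ (λ h → ∀Fin-elim m _ h (opposite j₀)) (cong (not ∘ isUp) mirror-up)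

  layerCount-suc : (S ⊆ᵇ M) ≡ true → ∀ b → layerCount b M S ≡ suc X
  layerCount-suc S⊆M false = layerCount-false
  layerCount-suc S⊆M true = by-emptiness (none S) refl
    where
    by-emptiness : ∀ y → none S ≡ y → layerCount true M S ≡ suc X
    by-emptiness true e = layerCount-empty e
    by-emptiness false e = layerCount-nonempty S⊆M e

module FreeColumns {m} (b : Bool) (s : Shape m) (f : Filling m) (S : Vec Bool m) where
  open AddLayer b s f S
  open ≡-Reasoning

  M : Fin m → Bool
  M = isFree (s , f)

  M' : Fin (suc (suc m)) → Bool
  M' = isFree (s' , f')

  column-no-up : ∀ k → ∀Fin (suc (suc m)) (λ p → not (isUp (at f' p k)))
                       ≡ not (isUp (F zero k)) ∧ ∀Fin m (λ p → not (isUp (F (mid p) k)))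
  column-no-up k = begin
    ∀Fin _ (λ p → not (isUp (at f' p k)))           ≡⟨ ∀Fin-cong _ (λ p → cong (not ∘ isUp) (entry p k)) ⟩
    ∀Fin _ (λ p → not (isUp (F p k)))               ≡⟨ ∀Fin-positions m (λ p → not (isUp (F p k))) ⟩
    A ∧ B ∧ not (isUp (F final k))                  ≡⟨ cong (λ z → A ∧ B ∧ not (isUp z)) (F-final k) ⟩
    A ∧ B ∧ true                                     ≡⟨ cong (A ∧_) (∧-identityʳ B) ⟩
    A ∧ B                                            ∎
    where
    A B : Bool
    A = not (isUp (F zero k))
    B = ∀Fin m (λ p → not (isUp (F (mid p) k)))

  free-first : M' zero ≡ isWest (firstStep b S)
  free-first = begin
    isWest (firstStep b S) ∧ ∀Fin _ (λ p → not (isUp (at f' p zero)))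
      ≡⟨ cong (isWest (firstStep b S) ∧_) (trans (column-no-up zero)
           (∀Fin-intro m _ λ p → cong (not ∘ isUp) (F-mid-first p))) ⟩
    isWest (firstStep b S) ∧ true
      ≡⟨ ∧-identityʳ _ ⟩
    isWest (firstStep b S) ∎

  free-mid : ∀ j → M' (mid j) ≡ M j ∧ not (isUp (topRow b S j))
  free-mid j = begin
    isWest (lookup s' (mid j)) ∧ ∀Fin _ (λ p → not (isUp (at f' p (mid j))))
      ≡⟨ cong₂ _∧_ (cong isWest (shape-mid j)) (trans (column-no-up (mid j))
           (cong₂ _∧_ (cong (not ∘ isUp) (F-first-mid j)) (∀Fin-cong m (λ p → cong (not ∘ isUp) (F-mid p j))))) ⟩
    W ∧ (T₀ ∧ C)  ≡⟨ cong (W ∧_) (∧-comm T₀ C) ⟩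
    W ∧ (C ∧ T₀)  ≡⟨ ∧-assoc W C T₀ ⟨
    (W ∧ C) ∧ T₀  ∎
    where
    W T₀ C : Bool
    W = isWest (lookup s j)
    T₀ = not (isUp (topRow b S j))
    C = ∀Fin m (λ p → not (isUp (at f p j)))

  free-final : M' final ≡ isWest (swapStep (firstStep b S)) ∧ ∀Fin m (λ i → not (isUp (finalColumn b S i)))
  free-final = cong₂ _∧_ (cong isWest shape-final) (trans (column-no-up final)
    (cong₂ _∧_ (cong (not ∘ isUp) F-first-final) (∀Fin-cong m (λ p → cong (not ∘ isUp) (F-mid-final p)))))

  #free-add : (S ⊆ᵇ M) ≡ true → #free (s' , f') ≡ suc (#Fin m (λ j → M j ∧ not (lookup S j)))
  #free-add S-free = begin
    #free (s' , f')
      ≡⟨ #Fin-positions m M' ⟩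
    ⟦ M' zero ⟧ + #Fin m (M' ∘ mid) + ⟦ M' final ⟧
      ≡⟨ cong₂ _+_ (cong₂ _+_ (cong ⟦_⟧ free-first) (#Fin-cong m free-mid)) (cong ⟦_⟧ free-final) ⟩
    layerCount b M S
      ≡⟨ layerCount-suc M S S-free b ⟩
    suc (#Fin m (λ j → M j ∧ not (lookup S j))) ∎

IsSymAlt : ∀ {m} → Raw m → Set
IsSymAlt x = T (isAlternative x) × (transpose x ≡ x)

SymAlt : ℕ → Set
SymAlt m = Σ (Raw m) IsSymAlt

-- Equality of raw tableaux is decidable, so proofs of transpose x ≡ x are
-- unique and IsSymAlt x is proof-irrelevant.
step-≟ : DecidableEquality Step
step-≟ south south = yes refl
step-≟ south west = no λ ()
step-≟ west south = no λ ()
step-≟ west west = yes refl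

content-≟ : DecidableEquality Content
content-≟ empty empty = yes refl
content-≟ left left = yes refl
content-≟ up up = yes refl
content-≟ empty left = no λ ()
content-≟ empty up = no λ ()
content-≟ left empty = no λ ()
content-≟ left up = no λ ()
content-≟ up empty = no λ ()
content-≟ up left = no λ ()

raw-≟ : ∀ {m} → DecidableEquality (Raw m)
raw-≟ = PP.≡-dec (VP.≡-dec step-≟) (VP.≡-dec (VP.≡-dec content-≟))

IsSymAlt-irrelevant : ∀ {m} (x : Raw m) (p q : IsSymAlt x) → p ≡ q
IsSymAlt-irrelevant x (a , b) (c , d) = cong₂ _,_ (T-irrelevant a c) (UIP.Decidable⇒UIP.≡-irrelevant raw-≟ b d)

Admissible : ∀ {m} → Bool × Raw m × Vec Bool m → Set
Admissible (b , x , S) = IsSymAlt x × T (S ⊆ᵇ isFree x)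

Admissible-irrelevant : ∀ {m} (i : Bool × Raw m × Vec Bool m) (p q : Admissible i) → p ≡ q
Admissible-irrelevant (b , x , S) (a , c) (a' , c') = cong₂ _,_ (IsSymAlt-irrelevant x a a') (T-irrelevant c c')

LayerData : ℕ → Set
LayerData m = Σ (Bool × Raw m × Vec Bool m) Admissible

Σ-restrict-↔ : ∀ {X Y : Set} {P : X → Set} {Q : Y → Set} →
  (∀ x (p q : P x) → p ≡ q) → (∀ y (p q : Q y) → p ≡ q) →
  (f : X → Y) (g : Y → X) (fP : ∀ x → P x → Q (f x)) (gQ : ∀ y → Q y → P (g y)) →
  (∀ x → P x → g (f x) ≡ x) → (∀ y → Q y → f (g y) ≡ y) → Σ X P ↔ Σ Y Q
Σ-restrict-↔ {P = P} {Q} irrP irrQ f g fP gQ gf fg =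
  mk↔ₛ′ (λ (x , p) → f x , fP x p) (λ (y , q) → g y , gQ y q)
        (λ (y , q) → Σ-≡ irrQ (fg y q)) (λ (x , p) → Σ-≡ irrP (gf x p))
  where
  Σ-≡ : ∀ {X : Set} {R : X → Set} → (∀ x (p q : R x) → p ≡ q) →
        ∀ {x y} {p : R x} {q : R y} → x ≡ y → (x , p) ≡ (y , q)
  Σ-≡ irr {x} {p = p} {q} refl = cong (x ,_) (irr x p q)

layer-decomposition : ∀ {m} → LayerData m ↔ SymAlt (suc (suc m))
layer-decomposition {m} =
  Σ-restrict-↔ Admissible-irrelevant IsSymAlt-irrelevant (λ (b , x , S) → addLayer b x S) peelLayer add-ok peel-ok
    (λ (b , (s , f) , S) _ → peel-add b s f S) add-peel
  where
  add-ok : ∀ i → Admissible i → IsSymAlt (addLayer (proj₁ i) (proj₁ (proj₂ i)) (proj₂ (proj₂ i)))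
  add-ok (b , (s , f) , S) ((a , e) , k) =
    valid⇒alternative _ _ P.valid , symmetric⇒transpose _ _ P.symmetric
    where module P = AddLayerPreserves b s f S (alternative⇒valid s f a) (transpose⇒symmetric s f e) (T⇒≡ k)
  peel-ok : ∀ y → IsSymAlt y → Admissible (peelLayer y)
  peel-ok (s' , f') (a , e) =
    (valid⇒alternative _ _ P.inner-valid , symmetric⇒transpose _ _ P.inner-symmetric) , ≡⇒T P.S-free
    where module P = PeelLayer s' f' (alternative⇒valid s' f' a) (transpose⇒symmetric s' f' e)
  add-peel : ∀ y → IsSymAlt y →
             addLayer (proj₁ (peelLayer y)) (proj₁ (proj₂ (peelLayer y))) (proj₂ (proj₂ (peelLayer y))) ≡ y
  add-peel (s' , f') (a , e) = PeelLayer.addLayer-peel s' f' (alternative⇒valid s' f' a) (transpose⇒symmetric s' f' e)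

-- Labelled subsets: a subset S ⊆ M with a labelling of M ∖ S by Fin w
-- amounts to a labelling of M by Fin (w+1), the extra label fromℕ w
-- marking the elements of S.
Labelled : ℕ → ∀ m → (Fin m → Bool) → Set
Labelled w m M = Σ (Vec Bool m) (λ S → T (S ⊆ᵇ M) × Vec (Fin w) (#Fin m (λ j → M j ∧ not (lookup S j))))

-- Labelled w (suc m) M with the head of M (whether 0 ∈ M) made a parameter c.
LabelledCons : ℕ → ∀ m → Bool → (Fin m → Bool) → Set
LabelledCons w m c M = Σ (Bool × Vec Bool m) (λ (x , S) → T ((x ⇒ᵇ c) ∧ (S ⊆ᵇ M)) ×
                         Vec (Fin w) (⟦ c ∧ not x ⟧ + #Fin m (λ j → M j ∧ not (lookup S j))))

module _ (w m : ℕ) (M : Fin m → Bool) (ih : Labelled w m M ↔ Vec (Fin (suc w)) (#Fin m M)) where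
  private
    to′ : Labelled w m M → Vec (Fin (suc w)) (#Fin m M)
    to′ = Inverse.to ih
    from′ : Vec (Fin (suc w)) (#Fin m M) → Labelled w m M
    from′ = Inverse.from ih

  -- A new element of M is either in S (label fromℕ w) or labelled by Fin w.
  labelledCons-member : LabelledCons w m true M ↔ Vec (Fin (suc w)) (suc (#Fin m M))
  labelledCons-member = mk↔ₛ′ to from to-from from-to
    where
    to : LabelledCons w m true M → Vec (Fin (suc w)) (suc (#Fin m M))
    to ((true , S) , p , v) = fromℕ w ∷ to′ (S , p , v)
    to ((false , S) , p , c ∷ v) = inject₁ c ∷ to′ (S , p , v)
    place : ∀ {c} → Top.View c → Labelled w m M → LabelledCons w m true M
    place Top.‵fromℕ (S , p , v) = (true , S) , p , v
    place (Top.‵inject₁ c) (S , p , v) = (false , S) , p , c ∷ v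
    from : Vec (Fin (suc w)) (suc (#Fin m M)) → LabelledCons w m true M
    from (c ∷ u) = place (Top.view c) (from′ u)
    to-place : ∀ {c} (vw : Top.View c) y → to (place vw y) ≡ c ∷ to′ y
    to-place Top.‵fromℕ (S , p , v) = refl
    to-place (Top.‵inject₁ c) (S , p , v) = refl
    to-from : ∀ u → to (from u) ≡ u
    to-from (c ∷ u) = trans (to-place (Top.view c) (from′ u)) (cong (c ∷_) (Inverse.strictlyInverseˡ ih u))
    from-to : ∀ y → from (to y) ≡ y
    from-to ((true , S) , p , v) rewrite Top.view-fromℕ w =
      cong (place Top.‵fromℕ) (Inverse.strictlyInverseʳ ih (S , p , v))
    from-to ((false , S) , p , c ∷ v) rewrite Top.view-inject₁ c =
      cong (place (Top.‵inj₁ (Top.view c))) (Inverse.strictlyInverseʳ ih (S , p , v))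

  -- An element outside M is outside S and carries no label.
  labelledCons-nonmember : LabelledCons w m false M ↔ Vec (Fin (suc w)) (#Fin m M)
  labelledCons-nonmember = mk↔ₛ′ to from to-from from-to
    where
    to : LabelledCons w m false M → Vec (Fin (suc w)) (#Fin m M)
    to ((false , S) , p , v) = to′ (S , p , v)
    extend : Labelled w m M → LabelledCons w m false M
    extend (S , p , v) = (false , S) , p , v
    from : Vec (Fin (suc w)) (#Fin m M) → LabelledCons w m false M
    from u = extend (from′ u)
    to-from : ∀ u → to (from u) ≡ u
    to-from u = trans (to-extend (from′ u)) (Inverse.strictlyInverseˡ ih u)
      where
      to-extend : ∀ y → to (extend y) ≡ to′ y
      to-extend (S , p , v) = refl
    from-to : ∀ y → from (to y) ≡ y
    from-to ((false , S) , p , v) = cong extend (Inverse.strictlyInverseʳ ih (S , p , v))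

  labelledCons : ∀ c → LabelledCons w m c M ↔ Vec (Fin (suc w)) (⟦ c ⟧ + #Fin m M)
  labelledCons true = labelledCons-member
  labelledCons false = labelledCons-nonmember

labelled↔ : ∀ w m (M : Fin m → Bool) → Labelled w m M ↔ Vec (Fin (suc w)) (#Fin m M)
labelled↔ w zero M = mk↔ₛ′ (λ _ → []) (λ _ → [] , tt , []) (λ { [] → refl }) (λ { ([] , tt , []) → refl })
labelled↔ w (suc m) M = ↔-trans uncons (labelledCons w m (M ∘ suc) (labelled↔ w m (M ∘ suc)) (M zero))
  where
  uncons : Labelled w (suc m) M ↔ LabelledCons w m (M zero) (M ∘ suc)
  uncons = mk↔ₛ′ (λ { ((x ∷ S) , p , v) → (x , S) , p , v }) (λ { ((x , S) , p , v) → (x ∷ S) , p , v })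
                 (λ { ((x , S) , p , v) → refl }) (λ { ((x ∷ S) , p , v) → refl })

rising : ℕ → ℕ → ℕ
rising w zero = 1
rising w (suc n) = w * rising (suc w) n

rising-1 : ∀ n → rising 1 n ≡ n !
rising-1 n = trans (sym (ℕP.*-identityʳ (rising 1 n))) (rising-! 0 n)
  where
  rising-! : ∀ k n → rising (suc k) n * k ! ≡ (k + n) !
  rising-! k zero = trans (ℕP.*-identityˡ (k !)) (cong _! (sym (ℕP.+-identityʳ k)))
  rising-! k (suc n) = begin
    suc k * rising (suc (suc k)) n * k !   ≡⟨ cong (_* k !) (ℕP.*-comm (suc k) (rising (suc (suc k)) n)) ⟩
    rising (suc (suc k)) n * suc k * k !   ≡⟨ ℕP.*-assoc (rising (suc (suc k)) n) (suc k) (k !) ⟩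
    rising (suc (suc k)) n * (suc k) !     ≡⟨ rising-! (suc k) n ⟩
    (suc k + n) !                          ≡⟨ cong _! (sym (ℕP.+-suc k n)) ⟩
    (k + suc n) !                          ∎
    where open ≡-Reasoning

FreeLabelling : ℕ → ∀ {m} → SymAlt m → Set
FreeLabelling w t = Vec (Fin w) (#free (proj₁ t))

vec-length : ∀ {A : Set} {a b} → a ≡ b → Vec A a ↔ Vec A b
vec-length refl = ↔-refl

fin-size : ∀ {a b} → a ≡ b → Fin a ↔ Fin b
fin-size refl = ↔-refl

uncons-↔ : ∀ {A : Set} {n} → Vec A (suc n) ↔ (A × Vec A n)
uncons-↔ = mk↔ₛ′ (λ { (x ∷ v) → x , v }) (λ (x , v) → x ∷ v) (λ _ → refl) (λ { (x ∷ v) → refl })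

freeOutside : ∀ {m} → LayerData m → ℕ
freeOutside {m} ((b , x , S) , _) = #Fin m (λ j → isFree x j ∧ not (lookup S j))

labelling-add : ∀ {m} w (l : LayerData m) →
  FreeLabelling w (Inverse.to layer-decomposition l) ↔ (Fin w × Vec (Fin w) (freeOutside l))
labelling-add w ((b , (s , f) , S) , _ , k) =
  ↔-trans (vec-length (FreeColumns.#free-add b s f S (T⇒≡ k))) uncons-↔

layer-labelling : ∀ {m} w →
  Σ (SymAlt (suc (suc m))) (FreeLabelling w) ↔ (Bool × (Fin w × Σ (SymAlt m) (FreeLabelling (suc w))))
layer-labelling {m} w =
  ↔-trans (↔-sym (Σ-↔ layer-decomposition ↔-refl))
  (↔-trans (Σ-↔ ↔-refl (λ {l} → labelling-add w l))
  (↔-trans regroup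
           (↔-refl ×-↔ (↔-refl ×-↔ Σ-↔ ↔-refl (λ {t} → labelled↔ w m (isFree (proj₁ t)))))))
  where
  regroup : Σ (LayerData m) (λ l → Fin w × Vec (Fin w) (freeOutside l))
            ↔ (Bool × (Fin w × Σ (SymAlt m) (λ t → Labelled w m (isFree (proj₁ t)))))
  regroup = mk↔ₛ′ (λ { (((b , x , S) , (g , k)) , (c , v)) → b , c , ((x , g) , (S , k , v)) })
                  (λ { (b , c , ((x , g) , (S , k , v))) → ((b , x , S) , (g , k)) , (c , v) })
                  (λ _ → refl) (λ _ → refl)

-- The weighted count: symmetric tableaux of length 2n with their free
-- columns labelled by Fin w are counted by 2ⁿ · w(w+1)⋯(w+n-1).  (The
-- length is kept as a separate index m since 2 * suc n is not
-- definitionally suc (suc (2 * n)).)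
weighted-count : ∀ n m → m ≡ 2 * n → ∀ w → Σ (SymAlt m) (FreeLabelling w) ↔ Fin (2 ^ n * rising w n)
weighted-count zero zero refl w = mk↔ₛ′ (λ _ → zero) (λ _ → (([] , []) , (tt , refl)) , [])
  (λ { zero → refl })
  (λ { ((([] , []) , g) , []) → cong (λ z → z , []) (cong (([] , []) ,_) (IsSymAlt-irrelevant _ _ g)) })
weighted-count (suc n) m eq w with trans eq (ℕP.*-suc 2 n)
... | refl =
  ↔-trans (layer-labelling w)
  (↔-trans (↔-sym FP.2↔Bool ×-↔ (↔-refl ×-↔ weighted-count n (2 * n) refl (suc w)))
  (↔-trans (↔-sym (↔-trans FP.*↔× (↔-refl ×-↔ FP.*↔×)))
           (fin-size (regroup-product w (2 ^ n) (rising (suc w) n)))))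
  where
  regroup-product : ∀ w P R → 2 * (w * (P * R)) ≡ (2 * P) * (w * R)
  regroup-product = solve 3 (λ w P R → con 2 :* (w :* (P :* R)) := (con 2 :* P) :* (w :* R)) refl

-- With a single label, a labelling carries no information.
unique-labelling : ∀ {m} → SymAlt m ↔ Σ (SymAlt m) (FreeLabelling 1)
unique-labelling =
  mk↔ₛ′ (λ t → t , replicate _ zero) proj₁ (λ (t , v) → cong (t ,_) (only-labelling v)) (λ _ → refl)
  where
  only-labelling : ∀ {k} (v : Vec (Fin 1) k) → replicate k zero ≡ v
  only-labelling [] = refl
  only-labelling (zero ∷ v) = cong (zero ∷_) (only-labelling v)

proposition3p6 : (n : ℕ) → SymAltTableau (2 * n) ↔ Fin (2 ^ n * n !)
proposition3p6 n =
  ↔-trans reassociate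
  (↔-trans unique-labelling
  (↔-trans (weighted-count n (2 * n) refl 1)
           (fin-size (cong (2 ^ n *_) (rising-1 n)))))
  where
  reassociate : SymAltTableau (2 * n) ↔ SymAlt (2 * n)
  reassociate = mk↔ₛ′ (λ ((x , a) , e) → x , a , e) (λ (x , a , e) → (x , a) , e) (λ _ → refl) (λ _ → refl)
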